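{- Let $k\in\mathbb{N}$ with $\gcd(k,6)=1$, let $h$ be an integer coprime to $k$, and let $h'$ be an integer with $hh'\equiv -1\pmod{k}$ and $6\mid h'$. Then $$\frac{\omega_{6h,k}\omega_{2h,k}\omega_{h,k}}{\omega_{3h,k}}=e^{ - \frac{2\pi i}{36k} \left(-9k+9k^2+h \left(-9+9k^2 \right) + h'\left(2-2k^2 \right) \right)}\qquad\text{and}\qquad \frac{\omega_{3h,k}\omega_{2h,k}\omega_{h,k}}{\omega_{6h,k}^3} =e^{\frac{2\pi i}{18k} \left(9h \left( k^2-1\right) + h'\left(k^2-1 \right) \right)}.$$
   Context: For coprime integers $h,K$ with $K\ge1$, let $h^\ast$ be any integer with $hh^\ast\equiv -1 \pmod K$ and set $$\omega_{h,K}:= \begin{cases} \left(\frac{ -K}{h} \right) e^{ -\pi i \left( \frac{1}{4}(2-hK-h)+\frac{1}{12}\left(K -\frac{1}{K} \right) \left(2h-h^\ast+h^2h^\ast\right)\right)}& \text{if } h \text{ is odd},\\ \left( \frac{ -h}{K} \right) e^{ -\pi i \left(\frac{1}{4}(K-1)+\frac{1}{12}\left(K-\frac{1}{K}\right) \left(2h-h^\ast+h^2h^\ast\right)\right) }& \text{if } K \text{ is odd},\end{cases}$$ with $\left(\frac{\cdot}{\cdot}\right)$ the Kronecker symbol (the standard eta-multiplier $e^{\pi i s(h,K)}$, $s$ the Dedekind sum; independent of the choice of $h^\ast$). -}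

module Defs where

open import Data.Nat as ℕ using (ℕ; zero; suc)
open import Data.Nat.Divisibility as ℕD using ()
open import Data.Integer as ℤ using (ℤ; +_; -[1+_])
open import Data.Integer.DivMod using (_%ℕ_)
open import Data.Integer.Divisibility as ℤD using ()
open import Data.Rational as ℚ using (ℚ)
open import Data.Bool using (Bool; true; false; if_then_else_)
open import Relation.Nullary.Decidable using (⌊_⌋)
open import Relation.Binary.PropositionalEquality using (_≡_)
open import Data.Product using (∃)

legendre : ℤ → (p : ℕ) → .{{_ : ℕ.NonZero p}} → ℤ
legendre a p with a %ℕ p
... | zero = + 0
... | r@(suc _) with ((r ℕ.^ ((p ℕ.∸ 1) ℕ./ 2)) ℕ.% p) ℕ.≡ᵇ 1
...   | true  = + 1
...   | false = -[1+ 0 ]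

kron2 : ℤ → ℤ
kron2 a with a %ℕ 8
... | 1 = + 1
... | 7 = + 1
... | 3 = -[1+ 0 ]
... | 5 = -[1+ 0 ]
... | _ = + 0

kronPrime : ℤ → ℕ → ℤ
kronPrime a 0 = + 0   -- not used (p prime)
kronPrime a 1 = + 0   -- not used (p prime)
kronPrime a 2 = kron2 a
kronPrime a p@(suc (suc _)) = legendre a p

smallestDivFrom : (fuel start n : ℕ) → ℕ
smallestDivFrom zero start n = n
smallestDivFrom (suc f) start n =
  if ⌊ start ℕD.∣? n ⌋ then start else smallestDivFrom f (suc start) n

minPrimeFactor : ℕ → ℕ
minPrimeFactor n = smallestDivFrom n 2 n

kronPosAux : (fuel : ℕ) → ℤ → ℕ → ℤ
kronPosAux zero a n = + 1
kronPosAux (suc f) a 0 = + 1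
kronPosAux (suc f) a 1 = + 1
kronPosAux (suc f) a n@(suc (suc _)) =
  let p = minPrimeFactor n in
  kronPrime a p ℤ.* kronPosAux f a (n ℕ./ (suc (ℕ.pred p)))

kronPos : ℤ → ℕ → ℤ
kronPos a n = kronPosAux n a n

kronecker : ℤ → ℤ → ℤ
kronecker a (+ 0) = if ⌊ ℤ.∣ a ∣ ℕ.≟ 1 ⌋ then + 1 else + 0
kronecker a (+ (suc n)) = kronPos a (suc n)
kronecker a n@(-[1+ _ ]) = signPart ℤ.* kronPos a ℤ.∣ n ∣
  where
  signPart : ℤ
  signPart = if ⌊ a ℤ.<? + 0 ⌋ then -[1+ 0 ] else + 1

-- Roots of unity are encoded by their angle: θ ∈ ℚ stands for e^{2πiθ}.
-- Two angles denote the same root of unity iff they differ by an integer.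

IsInteger : ℚ → Set
IsInteger q = ℚ.denominatorℕ q ≡ 1

_≈₁_ : ℚ → ℚ → Set
θ ≈₁ φ = IsInteger (θ ℚ.- φ)

infix 4 _≈₁_

-- angle of a sign ±1 (−1 = e^{2πi·1/2}, 1 = e^{0})
signAngle : ℤ → ℚ
signAngle -[1+ 0 ] = ℚ.½
signAngle _        = ℚ.0ℚ

-- h* : the least h* ∈ {0,…,K-1} with h h* ≡ -1 (mod K) (0 if none exists).
-- By the paper, ω does not depend on the choice of h*.

divides : ℕ → ℤ → Bool
divides zero z = ⌊ z ℤ.≟ + 0 ⌋
divides K@(suc _) z = (z %ℕ K) ℕ.≡ᵇ 0

hstarSearch : (fuel : ℕ) → ℤ → ℕ → ℕ → ℕ
hstarSearch zero h K n = 0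
hstarSearch (suc f) h K n =
  if divides K (h ℤ.* + n ℤ.+ + 1) then n else hstarSearch f h K (suc n)

hstar : ℤ → ℕ → ℤ
hstar h K = + hstarSearch K h K 0

_÷_ : ℤ → (n : ℕ) → .{{_ : ℕ.NonZero n}} → ℚ
z ÷ n = z ℚ./ n

isOddℤ : ℤ → Bool
isOddℤ z = (z %ℕ 2) ℕ.≡ᵇ 1

-- The angle θ of ω_{h,K} = e^{2πiθ}  (for coprime h, K with K ≥ 1).
-- e^{-πi x} = e^{2πi (-x/2)}.
-- The case "K odd" is used when K is odd, otherwise the case "h odd".
-- (For K = 0 the value is junk.)
ωangle : ℤ → ℕ → ℚ
ωangle h zero = ℚ.0ℚ
ωangle h K@(suc K') =
  if isOddℤ (+ K)
  then signAngle (kronecker (ℤ.- h) (+ K))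
       ℚ.- ℚ.½ ℚ.* (((+ K ℤ.- + 1) ÷ 4) ℚ.+ common)
  else signAngle (kronecker (ℤ.- (+ K)) h)
       ℚ.- ℚ.½ ℚ.* (((+ 2 ℤ.- h ℤ.* + K ℤ.- h) ÷ 4) ℚ.+ common)
  where
  hs : ℤ
  hs = hstar h K
  -- (1/12)(K - 1/K)(2h - h* + h² h*) = (K² - 1)(2h - h* + h² h*) / (12 K)
  common : ℚ
  common = ((+ K ℤ.* + K ℤ.- + 1) ℤ.* (+ 2 ℤ.* h ℤ.- hs ℤ.+ h ℤ.* h ℤ.* hs)) ÷ (12 ℕ.* K)

{-# OPTIONS --safe #-}
-- For odd k the angle of ω_{x,k} is N / 24k with N = 12kσ − 3k(k−1) − (k²−1)(2x − x* + x²x*),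
-- where σ ∈ {0,1} records the sign of the Kronecker symbol (−x/k). Since x x* ≡ −1 (mod k) and
-- 24 ∣ k²−1, N modulo 24k depends only on σ and on x* modulo k, and for x = 6h, 2h, h, 3h one may
-- take x* = h'/6, h'/2, h', h'/3. A polynomial identity then turns both combinations of numerators
-- into 36k times a combination of the σ's having the parity of their sum. That sum is even: the
-- Kronecker symbol is multiplicative in its numerator (by Euler's criterion, which rests on
-- Fermat's little theorem), and the four numerators −6h, −2h, −h, −3h multiply to (6h²)².
module Submission where

open import Defs
open import Data.Nat as ℕ using (ℕ; NonZero)
open import Data.Nat.GCD using (gcd)
open import Data.Nat.Properties using (m*n≢0)
open import Data.Integer as ℤ using (ℤ; +_)
open import Data.Integer.Divisibility using (_∣_)
open import Data.Integer.Coprimality using (Coprime)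
open import Data.Rational as ℚ using (ℚ)
open import Data.Product using (_×_)
open import Relation.Binary.PropositionalEquality using (_≡_)

open import Data.Bool using (T; true; false)
open import Data.Fin as Fin using (Fin; inject₁)
open import Data.Fin.Properties using (toℕ-inject₁; toℕ<n; toℕ-fromℕ)
open import Data.Integer using (-[1+_]; 0ℤ; 1ℤ; -1ℤ; _+_; _-_; -_; _*_; _^_; ∣_∣; _%ℕ_; _/ℕ_)
open import Data.Integer.DivMod using (a≡a%ℕn+[a/ℕn]*n; n%ℕd<d)
import Data.Integer.Divisibility.Signed as Signed
import Data.Integer.Properties as ℤ
open import Data.Integer.Tactic.RingSolver using (solve-∀)
open import Data.Nat using (zero; suc)
open import Data.Nat.Combinatorics using (_C_; nCn≡1; nCk≡n!/k![n-k]!; k![n∸k]!∣n!)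
import Data.Nat.Coprimality as ℕ
import Data.Nat.Divisibility as ℕ
open import Data.Nat.DivMod using (m/n*n≡m; m%n<n)
open import Data.Nat.Primality
  using (Prime; _Rough_; euclidsLemma; prime⇒nonZero; prime⇒nonTrivial; ¬prime[0]; ¬prime[1];
         rough∧∣⇒prime; ∤⇒rough-suc; 2-rough; prime?)
import Data.Nat.Properties as ℕ
open import Data.Product using (_,_; proj₁; proj₂)
open import Data.Rational using (mkℚ)
import Data.Rational.Properties as ℚ
open import Data.Rational.Unnormalised as ℚᵘ using (*≡*; mkℚᵘ)
import Data.Rational.Unnormalised.Properties as ℚᵘ
open import Data.Sum using (_⊎_; inj₁; inj₂; [_,_]′)
open import Data.Unit using (tt)
open import Function using (_∘_)
open import Relation.Binary.Bundles using (Setoid)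
open import Relation.Binary.PropositionalEquality
  using (_≢_; refl; sym; trans; cong; cong₂; subst; module ≡-Reasoning)
import Relation.Binary.Reasoning.Setoid as SetoidReasoning
open import Relation.Nullary using (¬_; contradiction; Dec; yes; no)
open import Relation.Nullary.Decidable using (map′; from-yes)
open import Algebra.Definitions.RawMonoid ℤ.+-0-rawMonoid using () renaming (_×_ to _×ℤ_)
open import Algebra.Properties.CommutativeSemiring.Binomial ℤ.+-*-commutativeSemiring using (binomialTerm; theorem)
open import Algebra.Properties.CommutativeSemiring.Exp ℤ.+-*-commutativeSemiring using (^-distrib-*)
open import Algebra.Properties.Group ℚ.+-0-group using (⁻¹-involutive)
open import Algebra.Properties.Monoid.Sum ℤ.+-0-monoid using (sum; sum-init-last)
open import Algebra.Properties.Semiring.Exp ℤ.+-*-semiring using () renaming (_^_ to _^′_)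

private variable
  a b c d n s t x y : ℤ
  k m p : ℕ

-- Congruences of integers

infix 4 _≡_mod_

-- A record, not a synonym for n ∣ a - b, so that a and b can be inferred from a proof.
record _≡_mod_ (a b n : ℤ) : Set where
  constructor ∣⇒≡-mod
  field ≡-mod⇒∣ : n Signed.∣ a - b

open _≡_mod_

≡-mod-reflexive : a ≡ b → a ≡ b mod n
≡-mod-reflexive {a} {n = n} refl =
  ∣⇒≡-mod (Signed.divides 0ℤ (trans (ℤ.+-inverseʳ a) (sym (ℤ.*-zeroˡ n))))

≡-mod-refl : a ≡ a mod n
≡-mod-refl = ≡-mod-reflexive refl

≡-mod-sym : a ≡ b mod n → b ≡ a mod n
≡-mod-sym {a} {b} (∣⇒≡-mod n∣a-b) = ∣⇒≡-mod (subst (_ Signed.∣_) (flip a b) (Signed.∣m⇒∣-m n∣a-b))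
  where
  flip : ∀ a b → - (a - b) ≡ b - a
  flip = solve-∀

≡-mod-trans : a ≡ b mod n → b ≡ c mod n → a ≡ c mod n
≡-mod-trans {a} {b} {c = c} (∣⇒≡-mod n∣a-b) (∣⇒≡-mod n∣b-c) =
  ∣⇒≡-mod (subst (_ Signed.∣_) (telescope a b c) (Signed.∣m∣n⇒∣m+n n∣a-b n∣b-c))
  where
  telescope : ∀ a b c → (a - b) + (b - c) ≡ a - c
  telescope = solve-∀

≡-mod-setoid : ℤ → Setoid _ _
≡-mod-setoid n = record
  { Carrier       = ℤ
  ; _≈_           = λ a b → a ≡ b mod n
  ; isEquivalence = record { refl = ≡-mod-refl ; sym = ≡-mod-sym ; trans = ≡-mod-trans }
  }

module ≡-mod-Reasoning (n : ℤ) = SetoidReasoning (≡-mod-setoid n)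

≡-mod-resp-modulus : ∀ {m} → n ≡ m → a ≡ b mod n → a ≡ b mod m
≡-mod-resp-modulus refl a≡b = a≡b

+-cong-mod : a ≡ b mod n → c ≡ d mod n → a + c ≡ b + d mod n
+-cong-mod {a} {b} {c = c} {d} (∣⇒≡-mod n∣a-b) (∣⇒≡-mod n∣c-d) =
  ∣⇒≡-mod (subst (_ Signed.∣_) (regroup a b c d) (Signed.∣m∣n⇒∣m+n n∣a-b n∣c-d))
  where
  regroup : ∀ a b c d → (a - b) + (c - d) ≡ (a + c) - (b + d)
  regroup = solve-∀

-‿cong-mod : a ≡ b mod n → - a ≡ - b mod n
-‿cong-mod {a} {b} (∣⇒≡-mod n∣a-b) = ∣⇒≡-mod (subst (_ Signed.∣_) (negate a b) (Signed.∣m⇒∣-m n∣a-b))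
  where
  negate : ∀ a b → - (a - b) ≡ - a - - b
  negate = solve-∀

*-cong-mod : a ≡ b mod n → c ≡ d mod n → a * c ≡ b * d mod n
*-cong-mod {a} {b} {c = c} {d} (∣⇒≡-mod n∣a-b) (∣⇒≡-mod n∣c-d) =
  ∣⇒≡-mod (subst (_ Signed.∣_) (regroup a b c d)
    (Signed.∣m∣n⇒∣m+n (Signed.∣n⇒∣m*n c n∣a-b) (Signed.∣n⇒∣m*n b n∣c-d)))
  where
  regroup : ∀ a b c d → c * (a - b) + b * (c - d) ≡ a * c - b * d
  regroup = solve-∀

*-monoʳ-≡-mod : ∀ c → a ≡ b mod n → c * a ≡ c * b mod c * n
*-monoʳ-≡-mod {a} {b} c (∣⇒≡-mod n∣a-b) =
  ∣⇒≡-mod (subst (_ Signed.∣_) (distrib c a b) (Signed.*-monoʳ-∣ c n∣a-b))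
  where
  distrib : ∀ c a b → c * (a - b) ≡ c * a - c * b
  distrib = solve-∀

^-cong-mod : ∀ k → a ≡ b mod n → a ^ k ≡ b ^ k mod n
^-cong-mod zero    a≡b = ≡-mod-refl
^-cong-mod (suc k) a≡b = *-cong-mod a≡b (^-cong-mod k a≡b)

∣⇒≡0-mod : n Signed.∣ a → a ≡ 0ℤ mod n
∣⇒≡0-mod {a = a} n∣a = ∣⇒≡-mod (subst (_ Signed.∣_) (sym (ℤ.+-identityʳ a)) n∣a)

≡0-mod⇒∣ : a ≡ 0ℤ mod n → n Signed.∣ a
≡0-mod⇒∣ {a} (∣⇒≡-mod n∣a-0) = subst (_ Signed.∣_) (ℤ.+-identityʳ a) n∣a-0

≡0-mod? : ∀ n a → Dec (a ≡ 0ℤ mod n)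
≡0-mod? n a = map′ ∣⇒≡0-mod ≡0-mod⇒∣ (n Signed.∣? a)

multiple≡0-mod : a * n ≡ 0ℤ mod n
multiple≡0-mod {a} = ∣⇒≡0-mod (Signed.divides a refl)

*-pres-≡0-mod : ∀ {m} → a ≡ 0ℤ mod m → b ≡ 0ℤ mod n → a * b ≡ 0ℤ mod m * n
*-pres-≡0-mod {n = n} {m} a≡0 b≡0 with ≡0-mod⇒∣ a≡0 | ≡0-mod⇒∣ b≡0
... | Signed.divides a′ refl | Signed.divides b′ refl =
  subst (λ z → z ≡ 0ℤ mod m * n) (sym (interchange a′ m b′ n)) (multiple≡0-mod {a = a′ * b′})
  where
  interchange : ∀ a m b n → (a * m) * (b * n) ≡ (a * b) * (m * n)
  interchange = solve-∀

≡-mod-%ℕ : ∀ a n .{{_ : NonZero n}} → a ≡ + (a %ℕ n) mod + n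
≡-mod-%ℕ a n = ∣⇒≡-mod (Signed.divides (a /ℕ n) (begin
  a - + r                  ≡⟨ cong (_- + r) (a≡a%ℕn+[a/ℕn]*n a n) ⟩
  + r + a /ℕ n * + n - + r ≡⟨ cancel (+ r) (a /ℕ n * + n) ⟩
  a /ℕ n * + n             ∎))
  where
  open ≡-Reasoning
  r : ℕ
  r = a %ℕ n
  cancel : ∀ r x → r + x - r ≡ x
  cancel = solve-∀

residue-unique : ∀ {n} r s → r ℕ.< n → s ℕ.< n → + r ≡ + s mod + n → r ≡ s
residue-unique zero    zero    _   _   _ = refl
residue-unique zero    (suc s) _   s<n (∣⇒≡-mod n∣-s) =
  contradiction (ℕ.∣⇒≤ (Signed.∣⇒∣ᵤ n∣-s)) (ℕ.<⇒≱ s<n)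
residue-unique (suc r) zero    r<n s<n r≡s =
  sym (residue-unique zero (suc r) s<n r<n (≡-mod-sym r≡s))
residue-unique (suc r) (suc s) r<n s<n (∣⇒≡-mod n∣r-s) =
  cong suc (residue-unique r s (ℕ.<-trans (ℕ.n<1+n r) r<n) (ℕ.<-trans (ℕ.n<1+n s) s<n)
    (∣⇒≡-mod (subst (_ Signed.∣_) shift n∣r-s)))
  where
  shift : + suc r - + suc s ≡ + r - + s
  shift = trans (ℤ.[1+m]⊖[1+n]≡m⊖n r s) (sym (ℤ.m-n≡m⊖n r s))

euclidsLemma-mod : Prime p → a * b ≡ 0ℤ mod + p → a ≡ 0ℤ mod + p ⊎ b ≡ 0ℤ mod + p
euclidsLemma-mod {p} {a} {b} pr ab≡0
  with euclidsLemma ∣ a ∣ ∣ b ∣ pr (subst (p ℕ.∣_) (ℤ.abs-* a b) (Signed.∣⇒∣ᵤ (≡0-mod⇒∣ ab≡0)))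
... | inj₁ p∣a = inj₁ (∣⇒≡0-mod (Signed.∣ᵤ⇒∣ p∣a))
... | inj₂ p∣b = inj₂ (∣⇒≡0-mod (Signed.∣ᵤ⇒∣ p∣b))

-- Fermat's little theorem

prime∣!⇒≤ : Prime p → p ℕ.∣ m ℕ.! → p ℕ.≤ m
prime∣!⇒≤ {m = zero}  pr p∣1 = contradiction (ℕ.∣1⇒≡1 p∣1) (ℕ.nonTrivial⇒≢1 {{prime⇒nonTrivial pr}})
prime∣!⇒≤ {m = suc m} pr p∣m+1! with euclidsLemma (suc m) (m ℕ.!) pr p∣m+1!
... | inj₁ p∣m+1 = ℕ.∣⇒≤ p∣m+1
... | inj₂ p∣m!  = ℕ.m≤n⇒m≤1+n (prime∣!⇒≤ pr p∣m!)

p∣pCk : Prime p → 0 ℕ.< k → k ℕ.< p → p ℕ.∣ p C k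
p∣pCk {p} {k} pr 0<k k<p
  with euclidsLemma (p C k) (k ℕ.! ℕ.* (p ℕ.∸ k) ℕ.!) pr (subst (p ℕ.∣_) (sym C*k![p-k]!≡p!) p∣p!)
  where
  instance
    _ = prime⇒nonZero pr
    _ = ℕ._!*_!≢0 k (p ℕ.∸ k)
  C*k![p-k]!≡p! : (p C k) ℕ.* (k ℕ.! ℕ.* (p ℕ.∸ k) ℕ.!) ≡ p ℕ.!
  C*k![p-k]!≡p! = trans (cong (ℕ._* (k ℕ.! ℕ.* (p ℕ.∸ k) ℕ.!)) (nCk≡n!/k![n-k]! (ℕ.<⇒≤ k<p)))
                        (m/n*n≡m (k![n∸k]!∣n! (ℕ.<⇒≤ k<p)))
  p∣p! : p ℕ.∣ p ℕ.!
  p∣p! = n∣n! p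
    where
    n∣n! : ∀ n .{{_ : NonZero n}} → n ℕ.∣ n ℕ.!
    n∣n! (suc q) = ℕ.m∣m*n (q ℕ.!)
... | inj₁ p∣C = p∣C
... | inj₂ p∣k![p-k]! with euclidsLemma (k ℕ.!) ((p ℕ.∸ k) ℕ.!) pr p∣k![p-k]!
...   | inj₁ p∣k!     = contradiction (prime∣!⇒≤ pr p∣k!) (ℕ.<⇒≱ k<p)
...   | inj₂ p∣[p-k]! = contradiction (prime∣!⇒≤ pr p∣[p-k]!) (ℕ.<⇒≱ (ℕ.∸-monoʳ-< 0<k (ℕ.<⇒≤ k<p)))

×ℤ≡* : ∀ k x → k ×ℤ x ≡ + k * x
×ℤ≡* zero    x = refl
×ℤ≡* (suc k) x = trans (cong (λ y → x + y) (×ℤ≡* k x)) (distrib x (+ k))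
  where
  distrib : ∀ x m → x + m * x ≡ (1ℤ + m) * x
  distrib = solve-∀

×ℤ-≡0-mod : p ℕ.∣ k → k ×ℤ x ≡ 0ℤ mod + p
×ℤ-≡0-mod {k = k} {x} p∣k =
  ∣⇒≡0-mod (subst (_ Signed.∣_) (sym (×ℤ≡* k x)) (Signed.∣m⇒∣m*n x (Signed.∣ᵤ⇒∣ {+ _} {+ k} p∣k)))

^′≡^ : ∀ x k → x ^′ k ≡ x ^ k
^′≡^ x zero    = refl
^′≡^ x (suc k) = cong (x *_) (^′≡^ x k)

sum-≡0-mod : ∀ {k} (f : Fin k → ℤ) → (∀ i → f i ≡ 0ℤ mod n) → sum f ≡ 0ℤ mod n
sum-≡0-mod {k = zero}  f f≡0 = ≡-mod-refl
sum-≡0-mod {k = suc k} f f≡0 = +-cong-mod (f≡0 Fin.zero) (sum-≡0-mod (f ∘ Fin.suc) (f≡0 ∘ Fin.suc))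

freshman-dream : Prime p → (1ℤ + x) ^ p ≡ 1ℤ + x ^ p mod + p
freshman-dream {p = p@(suc q)} {x} pr = begin
  (1ℤ + x) ^ p                                     ≡⟨ sym (^′≡^ (1ℤ + x) p) ⟩
  (1ℤ + x) ^′ p                                    ≡⟨ theorem p 1ℤ x ⟩
  term Fin.zero + sum (term ∘ Fin.suc)             ≡⟨ cong (λ s → term Fin.zero + s) (sum-init-last (term ∘ Fin.suc)) ⟩
  term Fin.zero + (sum inner + term (Fin.fromℕ p)) ≡⟨ cong₂ (λ a b → a + (sum inner + b)) first last ⟩
  x ^ p + (sum inner + 1ℤ)
    ≈⟨ +-cong-mod (≡-mod-refl {x ^ p}) (+-cong-mod (sum-≡0-mod inner inner≡0) (≡-mod-refl {1ℤ})) ⟩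
  x ^ p + (0ℤ + 1ℤ)                                ≡⟨ ℤ.+-comm (x ^ p) 1ℤ ⟩
  1ℤ + x ^ p                                       ∎
  where
  open ≡-mod-Reasoning (+ p)
  term : Fin (suc p) → ℤ
  term = binomialTerm 1ℤ x p
  inner : Fin q → ℤ
  inner i = term (Fin.suc (inject₁ i))
  inner≡0 : ∀ i → inner i ≡ 0ℤ mod + p
  inner≡0 i = ×ℤ-≡0-mod (p∣pCk pr ℕ.z<s (ℕ.s<s (subst (ℕ._< q) (sym (toℕ-inject₁ i)) (toℕ<n i))))
  first : term Fin.zero ≡ x ^ p
  first = trans (ℤ.+-identityʳ _) (trans (ℤ.*-identityˡ _) (^′≡^ x p))
  last : term (Fin.fromℕ p) ≡ 1ℤ
  last rewrite toℕ-fromℕ q | nCn≡1 p | ℕ.n∸n≡0 q =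
    trans (ℤ.+-identityʳ _) (trans (ℤ.*-identityʳ _) (trans (^′≡^ 1ℤ p) (ℤ.^-zeroˡ p)))

fermat-ℕ : Prime p → ∀ m → (+ m) ^ p ≡ + m mod + p
fermat-ℕ {p = suc _} pr zero    = ≡-mod-refl
fermat-ℕ {p = p}     pr (suc m) = begin
  (1ℤ + + m) ^ p  ≈⟨ freshman-dream pr ⟩
  1ℤ + (+ m) ^ p  ≈⟨ +-cong-mod (≡-mod-refl {1ℤ}) (fermat-ℕ pr m) ⟩
  1ℤ + + m        ∎
  where open ≡-mod-Reasoning (+ p)

fermat : Prime p → x ^ p ≡ x mod + p
fermat {p = p} {x = x} pr = begin
  x ^ p      ≈⟨ ^-cong-mod p x≡r ⟩
  (+ r) ^ p  ≈⟨ fermat-ℕ pr r ⟩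
  + r        ≈⟨ ≡-mod-sym x≡r ⟩
  x          ∎
  where
  open ≡-mod-Reasoning (+ p)
  instance _ = prime⇒nonZero pr
  r : ℕ
  r = x %ℕ p
  x≡r : x ≡ + r mod + p
  x≡r = ≡-mod-%ℕ x p

fermat-little : Prime p → ¬ x ≡ 0ℤ mod + p → x ^ (p ℕ.∸ 1) ≡ 1ℤ mod + p
fermat-little {p = suc q} {x} pr x≢0
  with euclidsLemma-mod pr (∣⇒≡0-mod (subst (_ Signed.∣_) (factor x (x ^ q)) (≡-mod⇒∣ (fermat {x = x} pr))))
  where
  factor : ∀ x y → x * y - x ≡ x * (y - 1ℤ)
  factor = solve-∀
... | inj₁ x≡0     = contradiction x≡0 x≢0
... | inj₂ x^q-1≡0 = ∣⇒≡-mod (≡0-mod⇒∣ x^q-1≡0)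

-- Signs, Euler's criterion and the Legendre symbol

IsSign : ℤ → Set
IsSign s = s ≡ 1ℤ ⊎ s ≡ -1ℤ

IsSign-* : IsSign a → IsSign b → IsSign (a * b)
IsSign-* (inj₁ refl) (inj₁ refl) = inj₁ refl
IsSign-* (inj₁ refl) (inj₂ refl) = inj₂ refl
IsSign-* (inj₂ refl) (inj₁ refl) = inj₂ refl
IsSign-* (inj₂ refl) (inj₂ refl) = inj₁ refl

*-IsSign⇒IsSign : IsSign (a * b) → IsSign a
*-IsSign⇒IsSign {a} {b} ab-sign =
  ∣∣≡1⇒IsSign a (ℕ.m*n≡1⇒m≡1 ∣ a ∣ ∣ b ∣ (trans (sym (ℤ.abs-* a b)) ∣ab∣≡1))
  where
  ∣ab∣≡1 : ∣ a * b ∣ ≡ 1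
  ∣ab∣≡1 = [ cong ∣_∣ , cong ∣_∣ ]′ ab-sign
  ∣∣≡1⇒IsSign : ∀ a → ∣ a ∣ ≡ 1 → IsSign a
  ∣∣≡1⇒IsSign (+ 1)            _ = inj₁ refl
  ∣∣≡1⇒IsSign -[1+ 0 ]         _ = inj₂ refl
  ∣∣≡1⇒IsSign (+ 0)            ()
  ∣∣≡1⇒IsSign (+ suc (suc _))  ()
  ∣∣≡1⇒IsSign -[1+ suc _ ]     ()

sign*sign≡1 : IsSign a → a * a ≡ 1ℤ
sign*sign≡1 (inj₁ refl) = refl
sign*sign≡1 (inj₂ refl) = refl

odd-prime∤2 : Prime p → ¬ 2 ℕ.∣ p → ¬ p ℕ.∣ 2
odd-prime∤2 {p} pr p-odd p∣2 = p-odd (subst (ℕ._∣ p) p≡2 ℕ.∣-refl)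
  where
  p≡2 : p ≡ 2
  p≡2 = ℕ.≤-antisym (ℕ.∣⇒≤ p∣2) (ℕ.nonTrivial⇒n>1 p {{prime⇒nonTrivial pr}})

1≢-1-mod : Prime p → ¬ 2 ℕ.∣ p → ¬ 1ℤ ≡ -1ℤ mod + p
1≢-1-mod pr p-odd (∣⇒≡-mod p∣2) = odd-prime∤2 pr p-odd (Signed.∣⇒∣ᵤ p∣2)

sign-≡-mod⇒≡ : Prime p → ¬ 2 ℕ.∣ p → IsSign a → IsSign b → a ≡ b mod + p → a ≡ b
sign-≡-mod⇒≡ pr p-odd (inj₁ refl) (inj₁ refl) _    = refl
sign-≡-mod⇒≡ pr p-odd (inj₂ refl) (inj₂ refl) _    = refl
sign-≡-mod⇒≡ pr p-odd (inj₁ refl) (inj₂ refl) 1≡-1 = contradiction 1≡-1 (1≢-1-mod pr p-odd)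
sign-≡-mod⇒≡ pr p-odd (inj₂ refl) (inj₁ refl) -1≡1 = contradiction (≡-mod-sym -1≡1) (1≢-1-mod pr p-odd)

square≡1⇒±1 : Prime p → x * x ≡ 1ℤ mod + p → x ≡ 1ℤ mod + p ⊎ x ≡ -1ℤ mod + p
square≡1⇒±1 {x = x} pr (∣⇒≡-mod p∣x²-1)
  with euclidsLemma-mod pr (∣⇒≡0-mod (subst (_ Signed.∣_) (difference-of-squares x) p∣x²-1))
  where
  difference-of-squares : ∀ x → x * x - 1ℤ ≡ (x - 1ℤ) * (x + 1ℤ)
  difference-of-squares = solve-∀
... | inj₁ x-1≡0 = inj₁ (∣⇒≡-mod (≡0-mod⇒∣ x-1≡0))
... | inj₂ x+1≡0 = inj₂ (∣⇒≡-mod (≡0-mod⇒∣ x+1≡0))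

odd⇒pred-even : ∀ q → ¬ 2 ℕ.∣ suc q → 2 ℕ.∣ q
odd⇒pred-even zero          _     = ℕ._∣0 2
odd⇒pred-even (suc zero)    2∤2   = contradiction ℕ.∣-refl 2∤2
odd⇒pred-even (suc (suc q)) 2∤q+3 =
  ℕ.∣m∣n⇒∣m+n ℕ.∣-refl (odd⇒pred-even q (λ 2∣q+1 → 2∤q+3 (ℕ.∣m∣n⇒∣m+n ℕ.∣-refl 2∣q+1)))

half+half : ¬ 2 ℕ.∣ suc k → k ℕ./ 2 ℕ.+ k ℕ./ 2 ≡ k
half+half {k} k+1-odd = begin
  h ℕ.+ h  ≡⟨ cong (h ℕ.+_) (ℕ.+-identityʳ h) ⟨
  2 ℕ.* h  ≡⟨ ℕ.*-comm 2 h ⟩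
  h ℕ.* 2  ≡⟨ m/n*n≡m (odd⇒pred-even k k+1-odd) ⟩
  k        ∎
  where
  open ≡-Reasoning
  h : ℕ
  h = k ℕ./ 2

pos-^ : ∀ m k → + (m ℕ.^ k) ≡ (+ m) ^ k
pos-^ m zero    = refl
pos-^ m (suc k) = trans (ℤ.pos-* m (m ℕ.^ k)) (cong (+ m *_) (pos-^ m k))

^-distribʳ-* : ∀ a b k → (a * b) ^ k ≡ a ^ k * b ^ k
^-distribʳ-* a b k =
  trans (sym (^′≡^ (a * b) k)) (trans (^-distrib-* a b k) (cong₂ _*_ (^′≡^ a k) (^′≡^ b k)))

euler-±1 : Prime p → ¬ 2 ℕ.∣ p → ¬ a ≡ 0ℤ mod + p →
           a ^ ((p ℕ.∸ 1) ℕ./ 2) ≡ 1ℤ mod + p ⊎ a ^ ((p ℕ.∸ 1) ℕ./ 2) ≡ -1ℤ mod + p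
euler-±1 {p = suc q} {a} pr p-odd a≢0 = square≡1⇒±1 pr (begin
  a ^ h * a ^ h  ≡⟨ ℤ.^-distribˡ-+-* a h h ⟨
  a ^ (h ℕ.+ h)  ≡⟨ cong (a ^_) (half+half p-odd) ⟩
  a ^ q          ≈⟨ fermat-little pr a≢0 ⟩
  1ℤ             ∎)
  where
  open ≡-mod-Reasoning (+ suc q)
  h : ℕ
  h = q ℕ./ 2

power-residue : ∀ {r} k .{{_ : NonZero p}} → a %ℕ p ≡ r → a ^ k ≡ + ((r ℕ.^ k) ℕ.% p) mod + p
power-residue {p} {a} {r} k a%p≡r = begin
  a ^ k                ≈⟨ ^-cong-mod k (subst (λ r → a ≡ + r mod + p) a%p≡r (≡-mod-%ℕ a p)) ⟩
  (+ r) ^ k            ≡⟨ pos-^ r k ⟨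
  + (r ℕ.^ k)          ≈⟨ ≡-mod-%ℕ (+ (r ℕ.^ k)) p ⟩
  + ((r ℕ.^ k) ℕ.% p)  ∎
  where open ≡-mod-Reasoning (+ p)

euler-criterion : .{{_ : NonZero p}} → Prime p → ¬ 2 ℕ.∣ p → ¬ a ≡ 0ℤ mod + p →
                  IsSign (legendre a p) × legendre a p ≡ a ^ ((p ℕ.∸ 1) ℕ./ 2) mod + p
euler-criterion {p} {a} pr p-odd a≢0 with a %ℕ p in a%p≡r
... | zero = contradiction (subst (λ r → a ≡ + r mod + p) a%p≡r (≡-mod-%ℕ a p)) a≢0
... | r@(suc _) with (r ℕ.^ h) ℕ.% p ℕ.≡ᵇ 1 in t≟1 | euler-±1 pr p-odd a≢0 | power-residue {a = a} h a%p≡r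
  where
  h : ℕ
  h = (p ℕ.∸ 1) ℕ./ 2
...   | true  | _           | a^h≡t =
  inj₁ refl , ≡-mod-sym (≡-mod-trans a^h≡t (≡-mod-reflexive (cong +_ (ℕ.≡ᵇ⇒≡ _ 1 (subst T (sym t≟1) tt)))))
...   | false | inj₂ a^h≡-1 | _     = inj₂ refl , ≡-mod-sym a^h≡-1
...   | false | inj₁ a^h≡1  | a^h≡t = contradiction t≡1 λ e → subst T t≟1 (ℕ.≡⇒≡ᵇ _ 1 e)
  where
  t≡1 : (r ℕ.^ ((p ℕ.∸ 1) ℕ./ 2)) ℕ.% p ≡ 1
  t≡1 = residue-unique _ 1 (m%n<n _ p) (ℕ.nonTrivial⇒n>1 p {{prime⇒nonTrivial pr}})
          (≡-mod-trans (≡-mod-sym a^h≡t) a^h≡1)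

legendre-≡0 : .{{_ : NonZero p}} → a ≡ 0ℤ mod + p → legendre a p ≡ 0ℤ
legendre-≡0 {p} {a} a≡0 with a %ℕ p in a%p≡r
... | zero  = refl
... | suc r =
  contradiction (residue-unique (suc r) 0 (subst (ℕ._< p) a%p≡r (n%ℕd<d a p)) (ℕ.>-nonZero⁻¹ p) r≡0) λ ()
  where
  r≡0 : + suc r ≡ 0ℤ mod + p
  r≡0 = subst (λ r → + r ≡ 0ℤ mod + p) a%p≡r (≡-mod-trans (≡-mod-sym (≡-mod-%ℕ a p)) a≡0)

-- As legendre a p = 0 when p ∣ a, no coprimality hypothesis is needed.
legendre-* : .{{_ : NonZero p}} → Prime p → ¬ 2 ℕ.∣ p → ∀ a b →
             legendre (a * b) p ≡ legendre a p * legendre b p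
legendre-* {p} pr p-odd a b with ≡0-mod? (+ p) a | ≡0-mod? (+ p) b
... | yes a≡0 | _ = begin
  legendre (a * b) p           ≡⟨ legendre-≡0 (*-cong-mod a≡0 (≡-mod-refl {b})) ⟩
  0ℤ                           ≡⟨ cong (_* legendre b p) (legendre-≡0 a≡0) ⟨
  legendre a p * legendre b p  ∎
  where open ≡-Reasoning
... | no _ | yes b≡0 = begin
  legendre (a * b) p           ≡⟨ legendre-≡0 ab≡0 ⟩
  0ℤ                           ≡⟨ ℤ.*-zeroʳ (legendre a p) ⟨
  legendre a p * 0ℤ            ≡⟨ cong (legendre a p *_) (legendre-≡0 b≡0) ⟨
  legendre a p * legendre b p  ∎
  where
  open ≡-Reasoning
  ab≡0 : a * b ≡ 0ℤ mod + p
  ab≡0 = subst (λ z → a * b ≡ z mod + p) (ℤ.*-zeroʳ a) (*-cong-mod (≡-mod-refl {a}) b≡0)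
... | no a≢0 | no b≢0
  with euler-criterion pr p-odd a≢0 | euler-criterion pr p-odd b≢0 | euler-criterion pr p-odd ab≢0
  where
  ab≢0 : ¬ a * b ≡ 0ℤ mod + p
  ab≢0 ab≡0 = [ a≢0 , b≢0 ]′ (euclidsLemma-mod pr ab≡0)
...   | a± , La≡a^h | b± , Lb≡b^h | ab± , Lab≡ab^h =
  sign-≡-mod⇒≡ pr p-odd ab± (IsSign-* a± b±) (begin
  legendre (a * b) p           ≈⟨ Lab≡ab^h ⟩
  (a * b) ^ h                  ≡⟨ ^-distribʳ-* a b h ⟩
  a ^ h * b ^ h                ≈⟨ *-cong-mod (≡-mod-sym La≡a^h) (≡-mod-sym Lb≡b^h) ⟩
  legendre a p * legendre b p  ∎)
  where
  open ≡-mod-Reasoning (+ p)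
  h : ℕ
  h = (p ℕ.∸ 1) ℕ./ 2

legendre-square : .{{_ : NonZero p}} → Prime p → ¬ 2 ℕ.∣ p → ¬ b ≡ 0ℤ mod + p → legendre (b * b) p ≡ 1ℤ
legendre-square {b = b} pr p-odd b≢0 =
  trans (legendre-* pr p-odd b b) (sign*sign≡1 (proj₁ (euler-criterion pr p-odd b≢0)))

-- The Kronecker symbol at an odd modulus

kronPrime≡legendre : (pr : Prime p) → ¬ 2 ℕ.∣ p → ∀ a → kronPrime a p ≡ legendre a p {{prime⇒nonZero pr}}
kronPrime≡legendre {zero}              pr _     = contradiction pr ¬prime[0]
kronPrime≡legendre {suc zero}          pr _     = contradiction pr ¬prime[1]
kronPrime≡legendre {suc (suc zero)}    _  p-odd = contradiction ℕ.∣-refl p-odd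
kronPrime≡legendre {suc (suc (suc _))} _  _     _ = refl

smallestDivFrom-spec : ∀ f s {n} → 2 ℕ.≤ s → 2 ℕ.≤ n → s Rough n → n ℕ.≤ s ℕ.+ f →
                       Prime (smallestDivFrom f s n) × smallestDivFrom f s n ℕ.∣ n
smallestDivFrom-spec zero s {n} _ 2≤n s-rough n≤s+0 =
  rough∧∣⇒prime {{ℕ.n>1⇒nonTrivial 2≤n}} n-rough ℕ.∣-refl , ℕ.∣-refl
  where
  n-rough : n Rough n
  n-rough d = s-rough (ℕ.hasNonTrivialDivisor-≤ d (subst (n ℕ.≤_) (ℕ.+-identityʳ s) n≤s+0))
smallestDivFrom-spec (suc f) s {n} 2≤s 2≤n s-rough n≤s+f+1 with s ℕ.∣? n
... | yes s∣n = rough∧∣⇒prime {{ℕ.n>1⇒nonTrivial 2≤s}} s-rough s∣n , s∣n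
... | no  s∤n = smallestDivFrom-spec f (suc s) (ℕ.m≤n⇒m≤1+n 2≤s) 2≤n (∤⇒rough-suc s∤n s-rough)
                  (subst (n ℕ.≤_) (ℕ.+-suc s f) n≤s+f+1)

∤-divisor : ¬ k ℕ.∣ m → ∀ {d} → d ℕ.∣ m → ¬ k ℕ.∣ d
∤-divisor k∤m d∣m k∣d = k∤m (ℕ.∣-trans k∣d d∣m)

module LeastPrimeFactor {n} (2≤n : 2 ℕ.≤ n) where
  factor-prime : Prime (minPrimeFactor n)
  factor-prime = proj₁ (smallestDivFrom-spec n 2 ℕ.≤-refl 2≤n 2-rough (ℕ.m≤n+m n 2))

  factor∣n : minPrimeFactor n ℕ.∣ n
  factor∣n = proj₂ (smallestDivFrom-spec n 2 ℕ.≤-refl 2≤n 2-rough (ℕ.m≤n+m n 2))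

  cofactor∣n : n ℕ./ suc (ℕ.pred (minPrimeFactor n)) ℕ.∣ n
  cofactor∣n = ℕ.m/n∣m (subst (ℕ._∣ n) (sym (ℕ.suc-pred _ {{prime⇒nonZero factor-prime}})) factor∣n)

kronPosAux-* : ∀ f n → ¬ 2 ℕ.∣ n → ∀ a b → kronPosAux f (a * b) n ≡ kronPosAux f a n * kronPosAux f b n
kronPosAux-* zero    n               _     a b = refl
kronPosAux-* (suc f) zero            _     a b = refl
kronPosAux-* (suc f) (suc zero)      _     a b = refl
kronPosAux-* (suc f) n@(suc (suc _)) n-odd a b =
  trans (cong₂ _*_ kronPrime-* (kronPosAux-* f _ (∤-divisor n-odd cofactor∣n) a b))
        (interchange (kronPrime a q) (kronPrime b q) _ _)
  where
  open LeastPrimeFactor {n} (ℕ.s≤s (ℕ.s≤s ℕ.z≤n))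
  q : ℕ
  q = minPrimeFactor n
  q-odd : ¬ 2 ℕ.∣ q
  q-odd = ∤-divisor n-odd factor∣n
  kronPrime-* : kronPrime (a * b) q ≡ kronPrime a q * kronPrime b q
  kronPrime-* rewrite kronPrime≡legendre factor-prime q-odd (a * b) | kronPrime≡legendre factor-prime q-odd a
                    | kronPrime≡legendre factor-prime q-odd b =
    legendre-* {{prime⇒nonZero factor-prime}} factor-prime q-odd a b
  interchange : ∀ a b c d → (a * b) * (c * d) ≡ (a * c) * (b * d)
  interchange = solve-∀

kronPosAux-square : ∀ f n → ¬ 2 ℕ.∣ n → (∀ {p} → Prime p → p ℕ.∣ n → ¬ b ≡ 0ℤ mod + p) →
                    kronPosAux f (b * b) n ≡ 1ℤ
kronPosAux-square zero    n               _     _ = refl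
kronPosAux-square (suc f) zero            _     _ = refl
kronPosAux-square (suc f) (suc zero)      _     _ = refl
kronPosAux-square {b} (suc f) n@(suc (suc _)) n-odd b⊥n =
  cong₂ _*_ kronPrime-square
    (kronPosAux-square f _ (∤-divisor n-odd cofactor∣n) (λ pr p∣ → b⊥n pr (ℕ.∣-trans p∣ cofactor∣n)))
  where
  open LeastPrimeFactor {n} (ℕ.s≤s (ℕ.s≤s ℕ.z≤n))
  q : ℕ
  q = minPrimeFactor n
  q-odd : ¬ 2 ℕ.∣ q
  q-odd = ∤-divisor n-odd factor∣n
  kronPrime-square : kronPrime (b * b) q ≡ 1ℤ
  kronPrime-square rewrite kronPrime≡legendre factor-prime q-odd (b * b) =
    legendre-square {{prime⇒nonZero factor-prime}} factor-prime q-odd (b⊥n factor-prime factor∣n)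

kronecker-product-square : ∀ {k s} .{{_ : NonZero k}} → ¬ 2 ℕ.∣ k →
  (∀ {p} → Prime p → p ℕ.∣ k → ¬ s ≡ 0ℤ mod + p) → a * b * c * d ≡ s * s →
  kronecker a (+ k) * kronecker b (+ k) * kronecker c (+ k) * kronecker d (+ k) ≡ 1ℤ
kronecker-product-square {a} {b} {c} {d} {k = k@(suc _)} {s} k-odd s⊥k abcd≡s² = begin
  χ a * χ b * χ c * χ d  ≡⟨ cong (λ z → z * χ c * χ d) (sym (χ-* a b)) ⟩
  χ (a * b) * χ c * χ d  ≡⟨ cong (_* χ d) (sym (χ-* (a * b) c)) ⟩
  χ (a * b * c) * χ d    ≡⟨ sym (χ-* (a * b * c) d) ⟩
  χ (a * b * c * d)      ≡⟨ cong χ abcd≡s² ⟩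
  χ (s * s)              ≡⟨ kronPosAux-square k k k-odd s⊥k ⟩
  1ℤ                     ∎
  where
  open ≡-Reasoning
  χ : ℤ → ℤ
  χ a = kronPosAux k a k
  χ-* : ∀ a b → χ (a * b) ≡ χ a * χ b
  χ-* = kronPosAux-* k k k-odd

signBit : ℤ → ℤ
signBit -[1+ 0 ] = 1ℤ
signBit _        = 0ℤ

signAngle≡signBit/2 : ∀ s → signAngle s ≡ signBit s ℚ./ 2
signAngle≡signBit/2 (+ _)        = refl
signAngle≡signBit/2 -[1+ 0 ]     = refl
signAngle≡signBit/2 -[1+ suc _ ] = refl

signBit-* : IsSign a → IsSign b → signBit (a * b) ≡ signBit a + signBit b mod + 2
signBit-* (inj₁ refl) (inj₁ refl) = ≡-mod-refl
signBit-* (inj₁ refl) (inj₂ refl) = ≡-mod-refl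
signBit-* (inj₂ refl) (inj₁ refl) = ≡-mod-refl
signBit-* (inj₂ refl) (inj₂ refl) = ∣⇒≡-mod (Signed.divides -1ℤ refl)

signBit-sum-even : a * b * c * d ≡ 1ℤ → signBit a + signBit b + signBit c + signBit d ≡ 0ℤ mod + 2
signBit-sum-even {a} {b} {c} {d} abcd≡1 = begin
  signBit a + signBit b + signBit c + signBit d
    ≈⟨ +-cong-mod (+-cong-mod (≡-mod-sym (signBit-* a± b±)) (≡-mod-refl {signBit c})) (≡-mod-refl {signBit d}) ⟩
  signBit (a * b) + signBit c + signBit d
    ≈⟨ +-cong-mod (≡-mod-sym (signBit-* ab± c±)) (≡-mod-refl {signBit d}) ⟩
  signBit (a * b * c) + signBit d
    ≈⟨ ≡-mod-sym (signBit-* abc± d±) ⟩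
  signBit (a * b * c * d)
    ≡⟨ cong signBit abcd≡1 ⟩
  0ℤ ∎
  where
  open ≡-mod-Reasoning (+ 2)
  abcd± : IsSign (a * b * c * d)
  abcd± = inj₁ abcd≡1
  abc± : IsSign (a * b * c)
  abc± = *-IsSign⇒IsSign {b = d} abcd±
  d± : IsSign d
  d± = *-IsSign⇒IsSign {b = a * b * c} (subst IsSign (ℤ.*-comm (a * b * c) d) abcd±)
  ab± : IsSign (a * b)
  ab± = *-IsSign⇒IsSign {b = c} abc±
  c± : IsSign c
  c± = *-IsSign⇒IsSign {b = a * b} (subst IsSign (ℤ.*-comm (a * b) c) abc±)
  a± : IsSign a
  a± = *-IsSign⇒IsSign {b = b} ab±
  b± : IsSign b
  b± = *-IsSign⇒IsSign {b = a} (subst IsSign (ℤ.*-comm a b) ab±)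

divides-sound : ∀ k z → divides (suc k) z ≡ true → z ≡ 0ℤ mod + suc k
divides-sound k z z%n≟0 =
  subst (λ r → z ≡ + r mod + suc k) (ℕ.≡ᵇ⇒≡ _ 0 (subst T (sym z%n≟0) tt)) (≡-mod-%ℕ z (suc k))

divides-complete : ∀ k z → z ≡ 0ℤ mod + suc k → divides (suc k) z ≡ true
divides-complete k z z≡0 with divides (suc k) z in z%n≟0
... | true  = refl
... | false = contradiction (subst T z%n≟0 (ℕ.≡⇒≡ᵇ _ 0 z%n≡0)) λ ()
  where
  z%n≡0 : z %ℕ suc k ≡ 0
  z%n≡0 = residue-unique _ 0 (n%ℕd<d z (suc k)) ℕ.z<s (≡-mod-trans (≡-mod-sym (≡-mod-%ℕ z (suc k))) z≡0)

hstarSearch-finds : ∀ f k s {n₀} → s ℕ.≤ n₀ → n₀ ℕ.< s ℕ.+ f → divides k (x * + n₀ + 1ℤ) ≡ true →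
                    divides k (x * + hstarSearch f x k s + 1ℤ) ≡ true
hstarSearch-finds zero k s s≤n₀ n₀<s+0 _ =
  contradiction (subst (_ ℕ.<_) (ℕ.+-identityʳ s) n₀<s+0) (ℕ.≤⇒≯ s≤n₀)
hstarSearch-finds {x} (suc f) k s {n₀} s≤n₀ n₀<s+f+1 n₀-found with divides k (x * + s + 1ℤ) in s-found
... | true  = s-found
... | false = hstarSearch-finds {x = x} f k (suc s) (ℕ.≤∧≢⇒< s≤n₀ s≢n₀)
                (subst (n₀ ℕ.<_) (ℕ.+-suc s f) n₀<s+f+1) n₀-found
  where
  s≢n₀ : s ≢ n₀
  s≢n₀ refl = contradiction (trans (sym n₀-found) s-found) λ ()

hstar-inverse : ∀ {k} .{{_ : NonZero k}} → x * y ≡ -1ℤ mod + k → x * hstar x k ≡ -1ℤ mod + k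
hstar-inverse {x} {y} {k@(suc k′)} xy≡-1 = ∣⇒≡-mod (≡0-mod⇒∣ (divides-sound k′ _
  (hstarSearch-finds {x = x} k k 0 ℕ.z≤n (n%ℕd<d y k) (divides-complete k′ _ xy%k≡-1))))
  where
  xy%k≡-1 : x * + (y %ℕ k) + 1ℤ ≡ 0ℤ mod + k
  xy%k≡-1 =
    ∣⇒≡0-mod (≡-mod⇒∣ (≡-mod-trans (*-cong-mod (≡-mod-refl {x}) (≡-mod-sym (≡-mod-%ℕ y k))) xy≡-1))

inverse-unique : x * a ≡ -1ℤ mod n → x * b ≡ -1ℤ mod n → a ≡ b mod n
inverse-unique {x} {a} {b = b} (∣⇒≡-mod n∣xa+1) (∣⇒≡-mod n∣xb+1) =
  ∣⇒≡-mod (subst (_ Signed.∣_) (expand x a b)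
    (Signed.∣m∣n⇒∣m-n (Signed.∣n⇒∣m*n a n∣xb+1) (Signed.∣n⇒∣m*n b n∣xa+1)))
  where
  expand : ∀ x a b → a * (x * b + 1ℤ) - b * (x * a + 1ℤ) ≡ a - b
  expand = solve-∀

hstar-≡ : ∀ {k} .{{_ : NonZero k}} → x * y ≡ -1ℤ mod + k → hstar x k ≡ y mod + k
hstar-≡ {x} {y} xy≡-1 = inverse-unique {x = x} (hstar-inverse {x = x} {y = y} xy≡-1) xy≡-1

-- Squares prime to 6

2∣n[n+1] : ∀ n → + 2 Signed.∣ + n * (+ n + 1ℤ)
2∣n[n+1] zero    = Signed.divides 0ℤ refl
2∣n[n+1] (suc n) =
  subst (_ Signed.∣_) (step (+ n)) (Signed.∣m∣n⇒∣m+n (2∣n[n+1] n) (Signed.divides (+ n + 1ℤ) refl))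
  where
  step : ∀ n → n * (n + 1ℤ) + (n + 1ℤ) * + 2 ≡ (1ℤ + n) * (1ℤ + n + 1ℤ)
  step = solve-∀

odd-square≡1-mod8 : ¬ 2 ℕ.∣ k → + k * + k ≡ 1ℤ mod + 8
odd-square≡1-mod8 {zero}  0-odd = contradiction (ℕ._∣0 2) 0-odd
odd-square≡1-mod8 {suc q} k-odd with odd⇒pred-even q k-odd
... | ℕ.divides j refl with 2∣n[n+1] j
...   | Signed.divides t j[j+1]≡t*2 = ∣⇒≡-mod (Signed.divides t (begin
  (1ℤ + + (j ℕ.* 2)) * (1ℤ + + (j ℕ.* 2)) - 1ℤ  ≡⟨ cong (λ m → (1ℤ + m) * (1ℤ + m) - 1ℤ) (ℤ.pos-* j 2) ⟩
  (1ℤ + + j * + 2) * (1ℤ + + j * + 2) - 1ℤ      ≡⟨ expand (+ j) ⟩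
  + j * (+ j + 1ℤ) * + 4                         ≡⟨ cong (_* + 4) j[j+1]≡t*2 ⟩
  t * + 2 * + 4                                  ≡⟨ ℤ.*-assoc t (+ 2) (+ 4) ⟩
  t * + 8                                        ∎))
  where
  open ≡-Reasoning
  expand : ∀ j → (1ℤ + j * + 2) * (1ℤ + j * + 2) - 1ℤ ≡ j * (j + 1ℤ) * + 4
  expand = solve-∀

prime[3] : Prime 3
prime[3] = from-yes (prime? 3)

square≡1-mod3 : ¬ 3 ℕ.∣ k → + k * + k ≡ 1ℤ mod + 3
square≡1-mod3 {k} 3∤k = subst (λ z → z ≡ 1ℤ mod + 3) (cong (+ k *_) (ℤ.*-identityʳ (+ k)))
  (fermat-little {x = + k} prime[3] (λ k≡0 → 3∤k (Signed.∣⇒∣ᵤ (≡0-mod⇒∣ k≡0))))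

-- 9 − 8 = 1 combines the two congruences.
mod8∧mod3⇒mod24 : a ≡ b mod + 8 → a ≡ b mod + 3 → a ≡ b mod + 24
mod8∧mod3⇒mod24 {a} {b} (∣⇒≡-mod (Signed.divides t a-b≡t*8)) (∣⇒≡-mod (Signed.divides s a-b≡s*3)) =
  ∣⇒≡-mod (Signed.divides (+ 3 * t - s) (begin
    a - b                              ≡⟨ nine-minus-eight (a - b) ⟩
    + 9 * (a - b) - + 8 * (a - b)      ≡⟨ cong₂ (λ x y → + 9 * x - + 8 * y) a-b≡t*8 a-b≡s*3 ⟩
    + 9 * (t * + 8) - + 8 * (s * + 3)  ≡⟨ collect t s ⟩
    (+ 3 * t - s) * + 24               ∎))
  where
  open ≡-Reasoning
  nine-minus-eight : ∀ n → n ≡ + 9 * n - + 8 * n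
  nine-minus-eight = solve-∀
  collect : ∀ t s → + 9 * (t * + 8) - + 8 * (s * + 3) ≡ (+ 3 * t - s) * + 24
  collect = solve-∀

square≡1-mod24 : ¬ 2 ℕ.∣ k → ¬ 3 ℕ.∣ k → + k * + k ≡ 1ℤ mod + 24
square≡1-mod24 k-odd 3∤k = mod8∧mod3⇒mod24 (odd-square≡1-mod8 k-odd) (square≡1-mod3 3∤k)

private
  toℚᵘ-/ : ∀ a n .{{_ : NonZero n}} → ℚ.toℚᵘ (a ℚ./ n) ℚᵘ.≃ a ℚᵘ./ n
  toℚᵘ-/ a (suc n) = ℚ.toℚᵘ-fromℚᵘ (mkℚᵘ a n)

/-cross : ∀ {m n} a b .{{_ : NonZero m}} .{{_ : NonZero n}} → a * + n ≡ b * + m → a ℚ./ m ≡ b ℚ./ n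
/-cross {m@(suc _)} {n@(suc _)} a b an≡bm =
  ℚ.toℚᵘ-injective (ℚᵘ.≃-trans (toℚᵘ-/ a m) (ℚᵘ.≃-trans (*≡* an≡bm) (ℚᵘ.≃-sym (toℚᵘ-/ b n))))

/-+ : ∀ a b m n .{{_ : NonZero m}} .{{_ : NonZero n}} →
      a ℚ./ m ℚ.+ b ℚ./ n ≡ ((a * + n + b * + m) ℚ./ (m ℕ.* n)) {{ℕ.m*n≢0 m n}}
/-+ a b m@(suc _) n@(suc _) = ℚ.toℚᵘ-injective (ℚᵘ.≃-trans (ℚ.toℚᵘ-homo-+ (a ℚ./ m) (b ℚ./ n))
  (ℚᵘ.≃-trans (ℚᵘ.+-cong (toℚᵘ-/ a m) (toℚᵘ-/ b n))
              (ℚᵘ.≃-sym (toℚᵘ-/ _ (m ℕ.* n) {{ℕ.m*n≢0 m n}}))))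

/-* : ∀ a b m n .{{_ : NonZero m}} .{{_ : NonZero n}} →
      (a ℚ./ m) ℚ.* (b ℚ./ n) ≡ ((a * b) ℚ./ (m ℕ.* n)) {{ℕ.m*n≢0 m n}}
/-* a b m@(suc _) n@(suc _) = ℚ.toℚᵘ-injective (ℚᵘ.≃-trans (ℚ.toℚᵘ-homo-* (a ℚ./ m) (b ℚ./ n))
  (ℚᵘ.≃-trans (ℚᵘ.*-cong (toℚᵘ-/ a m) (toℚᵘ-/ b n))
              (ℚᵘ.≃-sym (toℚᵘ-/ _ (m ℕ.* n) {{ℕ.m*n≢0 m n}}))))

-‿/ : ∀ a n .{{_ : NonZero n}} → ℚ.- (a ℚ./ n) ≡ (- a) ℚ./ n
-‿/ a n@(suc _) = ℚ.toℚᵘ-injective (ℚᵘ.≃-trans (ℚ.toℚᵘ-homo‿- (a ℚ./ n))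
  (ℚᵘ.≃-trans (ℚᵘ.-‿cong (toℚᵘ-/ a n)) (ℚᵘ.≃-sym (toℚᵘ-/ (- a) n))))

/-‿/ : ∀ a b m n .{{_ : NonZero m}} .{{_ : NonZero n}} →
       a ℚ./ m ℚ.- b ℚ./ n ≡ ((a * + n - b * + m) ℚ./ (m ℕ.* n)) {{ℕ.m*n≢0 m n}}
/-‿/ a b m n = trans (cong (a ℚ./ m ℚ.+_) (-‿/ b n)) (trans (/-+ a (- b) m n)
  (cong (λ z → ((a * + n + z) ℚ./ (m ℕ.* n)) {{ℕ.m*n≢0 m n}}) (sym (ℤ.neg-distribˡ-* b (+ m)))))

/-+-same : ∀ a b n .{{_ : NonZero n}} → a ℚ./ n ℚ.+ b ℚ./ n ≡ (a + b) ℚ./ n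
/-+-same a b n = trans (/-+ a b n n) (/-cross (a * + n + b * + n) (a + b) {{ℕ.m*n≢0 n n}} (begin
  (a * + n + b * + n) * + n   ≡⟨ factor a b (+ n) ⟩
  (a + b) * (+ n * + n)       ≡⟨ cong ((a + b) *_) (ℤ.pos-* n n) ⟨
  (a + b) * + (n ℕ.* n)       ∎))
  where
  open ≡-Reasoning
  factor : ∀ a b n → (a * n + b * n) * n ≡ (a + b) * (n * n)
  factor = solve-∀

/-‿-same : ∀ a b n .{{_ : NonZero n}} → a ℚ./ n ℚ.- b ℚ./ n ≡ (a - b) ℚ./ n
/-‿-same a b n = trans (cong (a ℚ./ n ℚ.+_) (-‿/ b n)) (/-+-same a (- b) n)

/-+₃-same : ∀ a b c n .{{_ : NonZero n}} → a ℚ./ n ℚ.+ b ℚ./ n ℚ.+ c ℚ./ n ≡ (a + b + c) ℚ./ n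
/-+₃-same a b c n = trans (cong (ℚ._+ c ℚ./ n) (/-+-same a b n)) (/-+-same (a + b) c n)

isInteger-/ : ∀ a n .{{_ : NonZero n}} → a ≡ 0ℤ mod + n → IsInteger (a ℚ./ n)
isInteger-/ a n@(suc _) a≡0 with ≡0-mod⇒∣ a≡0
... | Signed.divides t refl = cong ℚ.denominatorℕ a/n≡t
  where
  a/n≡t : (t * + n) ℚ./ n ≡ mkℚ t 0 (ℕ.sym (ℕ.1-coprimeTo ∣ t ∣))
  a/n≡t = ℚ.toℚᵘ-injective (ℚᵘ.≃-trans (toℚᵘ-/ (t * + n) n) (*≡* (ℤ.*-identityʳ (t * + n))))

/-scale : ∀ a c m k .{{_ : NonZero c}} .{{_ : NonZero m}} .{{_ : NonZero k}} →
          (a ℚ./ (m ℕ.* k)) {{ℕ.m*n≢0 m k}}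
          ≡ ((+ c * a) ℚ./ ((c ℕ.* m) ℕ.* k)) {{ℕ.m*n≢0 (c ℕ.* m) k {{ℕ.m*n≢0 c m}}}}
/-scale a c m k = /-cross a (+ c * a) {{ℕ.m*n≢0 m k}} {{ℕ.m*n≢0 (c ℕ.* m) k {{ℕ.m*n≢0 c m}}}} scaled
  where
  scaled : a * + ((c ℕ.* m) ℕ.* k) ≡ (+ c * a) * + (m ℕ.* k)
  scaled = begin
    a * + (c ℕ.* m ℕ.* k)         ≡⟨ cong (a *_) (trans (ℤ.pos-* (c ℕ.* m) k) (cong (_* + k) (ℤ.pos-* c m))) ⟩
    a * (+ c * + m * + k)         ≡⟨ regroup a (+ c) (+ m) (+ k) ⟩
    (+ c * a) * (+ m * + k)       ≡⟨ cong (+ c * a *_) (ℤ.pos-* m k) ⟨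
    (+ c * a) * + (m ℕ.* k)       ∎
    where
    open ≡-Reasoning
    regroup : ∀ a c m k → a * (c * m * k) ≡ c * a * (m * k)
    regroup = solve-∀

module _ (k : ℕ) .{{_ : NonZero k}} where
  private instance
    _ = ℕ.m*n≢0 24 k
    _ = ℕ.m*n≢0 18 k
    _ = ℕ.m*n≢0 36 k
    _ = ℕ.m*n≢0 72 k

  /24k+/36k : ∀ a b → a ℚ./ (24 ℕ.* k) ℚ.+ b ℚ./ (36 ℕ.* k) ≡ (+ 3 * a + + 2 * b) ℚ./ (72 ℕ.* k)
  /24k+/36k a b = trans (cong₂ ℚ._+_ (/-scale a 3 24 k) (/-scale b 2 36 k)) (/-+-same (+ 3 * a) (+ 2 * b) (72 ℕ.* k))

  /24k-/18k : ∀ a b → a ℚ./ (24 ℕ.* k) ℚ.- b ℚ./ (18 ℕ.* k) ≡ (+ 3 * a - + 4 * b) ℚ./ (72 ℕ.* k)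
  /24k-/18k a b = trans (cong₂ ℚ._-_ (/-scale a 3 24 k) (/-scale b 4 18 k)) (/-‿-same (+ 3 * a) (+ 4 * b) (72 ℕ.* k))

  sum-of-angles₁ : ∀ a b c d r →
    (a ℚ./ (24 ℕ.* k) ℚ.+ b ℚ./ (24 ℕ.* k) ℚ.+ c ℚ./ (24 ℕ.* k) ℚ.- d ℚ./ (24 ℕ.* k)) ℚ.- ℚ.- (r ℚ./ (36 ℕ.* k))
    ≡ (+ 3 * (a + b + c - d) + + 2 * r) ℚ./ (72 ℕ.* k)
  sum-of-angles₁ a b c d r = begin
    (a ℚ./ D ℚ.+ b ℚ./ D ℚ.+ c ℚ./ D ℚ.- d ℚ./ D) ℚ.- ℚ.- (r ℚ./ (36 ℕ.* k))
      ≡⟨ cong (ℚ._- ℚ.- (r ℚ./ (36 ℕ.* k)))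
              (trans (cong (ℚ._- d ℚ./ D) (/-+₃-same a b c D)) (/-‿-same (a + b + c) d D)) ⟩
    (a + b + c - d) ℚ./ D ℚ.- ℚ.- (r ℚ./ (36 ℕ.* k))
      ≡⟨ cong ((a + b + c - d) ℚ./ D ℚ.+_) (⁻¹-involutive (r ℚ./ (36 ℕ.* k))) ⟩
    (a + b + c - d) ℚ./ D ℚ.+ r ℚ./ (36 ℕ.* k)
      ≡⟨ /24k+/36k (a + b + c - d) r ⟩
    (+ 3 * (a + b + c - d) + + 2 * r) ℚ./ (72 ℕ.* k) ∎
    where
    open ≡-Reasoning
    D : ℕ
    D = 24 ℕ.* k

  sum-of-angles₂ : ∀ a b c d r →
    (a ℚ./ (24 ℕ.* k) ℚ.+ b ℚ./ (24 ℕ.* k) ℚ.+ c ℚ./ (24 ℕ.* k) ℚ.- (+ 3 ℚ./ 1) ℚ.* (d ℚ./ (24 ℕ.* k)))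
      ℚ.- r ℚ./ (18 ℕ.* k)
    ≡ (+ 3 * (a + b + c - + 3 * d) - + 4 * r) ℚ./ (72 ℕ.* k)
  sum-of-angles₂ a b c d r = begin
    (a ℚ./ D ℚ.+ b ℚ./ D ℚ.+ c ℚ./ D ℚ.- (+ 3 ℚ./ 1) ℚ.* (d ℚ./ D)) ℚ.- r ℚ./ (18 ℕ.* k)
      ≡⟨ cong (λ z → (a ℚ./ D ℚ.+ b ℚ./ D ℚ.+ c ℚ./ D ℚ.- z) ℚ.- r ℚ./ (18 ℕ.* k))
              (trans (/-* (+ 3) d 1 D) (ℚ./-cong {p₁ = + 3 * d} {{ℕ.m*n≢0 1 D}} refl (ℕ.*-identityˡ D))) ⟩
    (a ℚ./ D ℚ.+ b ℚ./ D ℚ.+ c ℚ./ D ℚ.- (+ 3 * d) ℚ./ D) ℚ.- r ℚ./ (18 ℕ.* k)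
      ≡⟨ cong (ℚ._- r ℚ./ (18 ℕ.* k))
              (trans (cong (ℚ._- (+ 3 * d) ℚ./ D) (/-+₃-same a b c D)) (/-‿-same (a + b + c) (+ 3 * d) D)) ⟩
    (a + b + c - + 3 * d) ℚ./ D ℚ.- r ℚ./ (18 ℕ.* k)
      ≡⟨ /24k-/18k (a + b + c - + 3 * d) r ⟩
    (+ 3 * (a + b + c - + 3 * d) - + 4 * r) ℚ./ (72 ℕ.* k) ∎
    where
    open ≡-Reasoning
    D : ℕ
    D = 24 ℕ.* k

-- The angle of ω at an odd modulus

odd⇒isOddℤ : ∀ {k} → ¬ 2 ℕ.∣ k → isOddℤ (+ k) ≡ true
odd⇒isOddℤ {k} k-odd with k ℕ.% 2 in k%2≡r | m%n<n k 2
... | 0           | _                     = contradiction (ℕ.m%n≡0⇒n∣m k 2 k%2≡r) k-odd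
... | 1           | _                     = refl
... | suc (suc _) | ℕ.s≤s (ℕ.s≤s ())

ωnumerator : ℤ → ℤ → ℤ → ℤ → ℤ
ωnumerator k x σ s = + 12 * k * σ - + 3 * k * (k - 1ℤ) - (k * k - 1ℤ) * (+ 2 * x - s + x * x * s)

ωangle-odd : ∀ {k} .{{_ : NonZero k}} → ¬ 2 ℕ.∣ k → ∀ x →
  ωangle x k ≡ (ωnumerator (+ k) x (signBit (kronecker (- x) (+ k))) (hstar x k) ℚ./ (24 ℕ.* k)) {{ℕ.m*n≢0 24 k}}
ωangle-odd {k@(suc _)} k-odd x rewrite odd⇒isOddℤ k-odd = begin
  signAngle σ ℚ.- ℚ.½ ℚ.* ((+ k - + 1) ÷ 4 ℚ.+ Y ÷ (12 ℕ.* k))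
    ≡⟨ cong₂ (λ a b → a ℚ.- ℚ.½ ℚ.* b) (signAngle≡signBit/2 σ) (/-+ (+ k - + 1) Y 4 (12 ℕ.* k)) ⟩
  signBit σ ℚ./ 2 ℚ.- ℚ.½ ℚ.* (N ℚ./ (4 ℕ.* (12 ℕ.* k)))
    ≡⟨ cong (λ z → signBit σ ℚ./ 2 ℚ.- z) (/-* (+ 1) N 2 (4 ℕ.* (12 ℕ.* k))) ⟩
  signBit σ ℚ./ 2 ℚ.- (+ 1 * N) ℚ./ (2 ℕ.* (4 ℕ.* (12 ℕ.* k)))
    ≡⟨ /-‿/ (signBit σ) (+ 1 * N) 2 (2 ℕ.* (4 ℕ.* (12 ℕ.* k))) ⟩
  (signBit σ * + (2 ℕ.* (4 ℕ.* (12 ℕ.* k))) - + 1 * N * + 2) ℚ./ (2 ℕ.* (2 ℕ.* (4 ℕ.* (12 ℕ.* k))))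
    ≡⟨ /-cross (signBit σ * + (2 ℕ.* (4 ℕ.* (12 ℕ.* k))) - + 1 * N * + 2) ωN cross ⟩
  ωN ℚ./ (24 ℕ.* k) ∎
  where
  open ≡-Reasoning
  σ x⋆ ωN Y N : ℤ
  σ = kronecker (- x) (+ k)
  x⋆ = hstar x k
  ωN = ωnumerator (+ k) x (signBit σ) x⋆
  Y = (+ k * + k - + 1) * (+ 2 * x - x⋆ + x * x * x⋆)
  N = (+ k - + 1) * + (12 ℕ.* k) + Y * + 4
  cross : (signBit σ * + (2 ℕ.* (4 ℕ.* (12 ℕ.* k))) - + 1 * N * + 2) * + (24 ℕ.* k)
        ≡ ωN * + (2 ℕ.* (2 ℕ.* (4 ℕ.* (12 ℕ.* k))))
  cross rewrite ℤ.pos-* 2 (2 ℕ.* (4 ℕ.* (12 ℕ.* k))) | ℤ.pos-* 2 (4 ℕ.* (12 ℕ.* k)) | ℤ.pos-* 4 (12 ℕ.* k)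
              | ℤ.pos-* 12 k | ℤ.pos-* 24 k = identity (signBit σ) (+ k) x x⋆
    where
    identity : ∀ σ k x s →
      (σ * (+ 2 * (+ 4 * (+ 12 * k)))
        - + 1 * ((k - + 1) * (+ 12 * k) + (k * k - + 1) * (+ 2 * x - s + x * x * s) * + 4) * + 2) * (+ 24 * k)
      ≡ (+ 12 * k * σ - + 3 * k * (k - 1ℤ) - (k * k - 1ℤ) * (+ 2 * x - s + x * x * s))
        * (+ 2 * (+ 2 * (+ 4 * (+ 12 * k))))
    identity = solve-∀

ωreduced : ℤ → ℤ → ℤ → ℤ → ℤ
ωreduced k x σ t = + 12 * k * σ - + 3 * k * (k - 1ℤ) - (k * k - 1ℤ) * (x - t)

ωnumerator-≡ : ∀ {k} σ → k * k ≡ 1ℤ mod + 24 → x * t ≡ -1ℤ mod k → s ≡ t mod k →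
               ωnumerator k x σ s ≡ ωreduced k x σ t mod + 24 * k
ωnumerator-≡ {x} {t} {s} {k} σ (∣⇒≡-mod 24∣k²-1) (∣⇒≡-mod k∣xt+1) (∣⇒≡-mod k∣s-t) =
  ∣⇒≡-mod (subst (_ Signed.∣_) (sym (difference k x σ s t))
    (Signed.∣m⇒∣-m (≡0-mod⇒∣ (*-pres-≡0-mod (∣⇒≡0-mod 24∣k²-1) (∣⇒≡0-mod k∣bracket)))))
  where
  k∣bracket : k Signed.∣ (x * x - 1ℤ) * (s - t) + x * (x * t + 1ℤ)
  k∣bracket = Signed.∣m∣n⇒∣m+n (Signed.∣n⇒∣m*n (x * x - 1ℤ) k∣s-t) (Signed.∣n⇒∣m*n x k∣xt+1)
  difference : ∀ k x σ s t →
    ωnumerator k x σ s - ωreduced k x σ t ≡ - ((k * k - 1ℤ) * ((x * x - 1ℤ) * (s - t) + x * (x * t + 1ℤ)))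
  difference = identity
    where
    identity : ∀ k x σ s t →
      (+ 12 * k * σ - + 3 * k * (k - 1ℤ) - (k * k - 1ℤ) * (+ 2 * x - s + x * x * s))
        - (+ 12 * k * σ - + 3 * k * (k - 1ℤ) - (k * k - 1ℤ) * (x - t))
      ≡ - ((k * k - 1ℤ) * ((x * x - 1ℤ) * (s - t) + x * (x * t + 1ℤ)))
    identity = solve-∀

-- The two quotients of multipliers

module MultiplierQuotients
  (k : ℕ) .{{_ : NonZero k}} (k-odd : ¬ 2 ℕ.∣ k) (3∤k : ¬ 3 ℕ.∣ k)
  (h : ℤ) (6hh⊥k : ∀ {p} → Prime p → p ℕ.∣ k → ¬ + 6 * h * h ≡ 0ℤ mod + p)
  (u : ℤ) (hu≡-1 : h * (u * + 6) ≡ -1ℤ mod + k) where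

  k²≡1 : + k * + k ≡ 1ℤ mod + 24
  k²≡1 = square≡1-mod24 k-odd 3∤k

  σ : ℤ → ℤ
  σ x = signBit (kronecker (- x) (+ k))

  θ : ℤ → ℤ
  θ x = ωnumerator (+ k) x (σ x) (hstar x k)

  ωangle≡θ : ∀ x → ωangle x k ≡ (θ x ℚ./ (24 ℕ.* k)) {{ℕ.m*n≢0 24 k}}
  ωangle≡θ = ωangle-odd k-odd

  -- c is the multiplier turning x into 6h, so c u inverts −x modulo k.
  θ-≡ : ∀ {x} c → c * x ≡ + 6 * h → θ x ≡ ωreduced (+ k) x (σ x) (c * u) mod + 24 * + k
  θ-≡ {x} c cx≡6h = ωnumerator-≡ {x = x} {t = c * u} (σ x) k²≡1 xcu≡-1 (hstar-≡ {x = x} xcu≡-1)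
    where
    xcu≡-1 : x * (c * u) ≡ -1ℤ mod + k
    xcu≡-1 = subst (λ z → z ≡ -1ℤ mod + k)
                   (trans (regroup h u) (sym (trans (regroup′ x c u) (cong (_* u) cx≡6h)))) hu≡-1
      where
      regroup : ∀ h u → h * (u * + 6) ≡ + 6 * h * u
      regroup = solve-∀
      regroup′ : ∀ x c u → x * (c * u) ≡ c * x * u
      regroup′ = solve-∀

  private
    36k*even≡0 : ∀ {e} → e ≡ 0ℤ mod + 2 → + 36 * + k * e ≡ 0ℤ mod + 72 * + k
    36k*even≡0 e≡0 =
      ≡-mod-resp-modulus (double (+ k)) (*-pres-≡0-mod {a = + 36 * + k} (∣⇒≡0-mod Signed.∣-refl) e≡0)
      where
      double : ∀ k → + 36 * k * + 2 ≡ + 72 * k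
      double = solve-∀

    scale-mod : a ≡ b mod + 24 * + k → + 3 * a ≡ + 3 * b mod + 72 * + k
    scale-mod a≡b = ≡-mod-resp-modulus (triple (+ k)) (*-monoʳ-≡-mod (+ 3) a≡b)
      where
      triple : ∀ k → + 3 * (+ 24 * k) ≡ + 72 * k
      triple = solve-∀

  σ-sum-even : σ (+ 6 * h) + σ (+ 2 * h) + σ h + σ (+ 3 * h) ≡ 0ℤ mod + 2
  σ-sum-even = signBit-sum-even {χ (+ 6 * h)} {χ (+ 2 * h)} {χ h} {χ (+ 3 * h)}
    (kronecker-product-square {a = - (+ 6 * h)} {b = - (+ 2 * h)} {c = - h} {d = - (+ 3 * h)} k-odd 6hh⊥k (squares h))
    where
    χ : ℤ → ℤ
    χ x = kronecker (- x) (+ k)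
    squares : ∀ h → - (+ 6 * h) * - (+ 2 * h) * - h * - (+ 3 * h) ≡ (+ 6 * h * h) * (+ 6 * h * h)
    squares = solve-∀

  R₁ R₂ : ℤ
  R₁ = - (+ 9 * + k) + + 9 * + k * + k + h * (- + 9 + + 9 * + k * + k) + (u * + 6) * (+ 2 - + 2 * + k * + k)
  R₂ = + 9 * h * (+ k * + k - + 1) + (u * + 6) * (+ k * + k - + 1)

  private
    σ₆ σ₂ σ₁ σ₃ θ₆ θ₂ θ₁ θ₃ : ℤ
    σ₆ = σ (+ 6 * h)
    σ₂ = σ (+ 2 * h)
    σ₁ = σ h
    σ₃ = σ (+ 3 * h)
    θ₆ = θ (+ 6 * h)
    θ₂ = θ (+ 2 * h)
    θ₁ = θ h
    θ₃ = θ (+ 3 * h)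
    ρ₆ ρ₂ ρ₁ ρ₃ : ℤ
    ρ₆ = ωreduced (+ k) (+ 6 * h) σ₆ (1ℤ * u)
    ρ₂ = ωreduced (+ k) (+ 2 * h) σ₂ (+ 3 * u)
    ρ₁ = ωreduced (+ k) h σ₁ (+ 6 * u)
    ρ₃ = ωreduced (+ k) (+ 3 * h) σ₃ (+ 2 * u)
    θ₆≡ρ₆ : θ₆ ≡ ρ₆ mod + 24 * + k
    θ₆≡ρ₆ = θ-≡ 1ℤ (ℤ.*-identityˡ (+ 6 * h))
    θ₂≡ρ₂ : θ₂ ≡ ρ₂ mod + 24 * + k
    θ₂≡ρ₂ = θ-≡ (+ 3) (sym (ℤ.*-assoc (+ 3) (+ 2) h))
    θ₁≡ρ₁ : θ₁ ≡ ρ₁ mod + 24 * + k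
    θ₁≡ρ₁ = θ-≡ (+ 6) refl
    θ₃≡ρ₃ : θ₃ ≡ ρ₃ mod + 24 * + k
    θ₃≡ρ₃ = θ-≡ (+ 2) (sym (ℤ.*-assoc (+ 2) (+ 3) h))

  first-numerator≡0 : + 3 * (θ₆ + θ₂ + θ₁ - θ₃) + + 2 * R₁ ≡ 0ℤ mod + 72 * + k
  first-numerator≡0 = begin
    + 3 * (θ₆ + θ₂ + θ₁ - θ₃) + + 2 * R₁
      ≈⟨ +-cong-mod (scale-mod (+-cong-mod (+-cong-mod (+-cong-mod θ₆≡ρ₆ θ₂≡ρ₂) θ₁≡ρ₁) (-‿cong-mod θ₃≡ρ₃)))
                    (≡-mod-refl {+ 2 * R₁}) ⟩
    + 3 * (ρ₆ + ρ₂ + ρ₁ - ρ₃) + + 2 * R₁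
      ≡⟨ identity (+ k) h u σ₆ σ₂ σ₁ σ₃ ⟩
    + 36 * + k * (σ₆ + σ₂ + σ₁ - σ₃)
      ≈⟨ 36k*even≡0 (subst (λ z → z ≡ 0ℤ mod + 2) (regroup σ₆ σ₂ σ₁ σ₃)
                           (+-cong-mod σ-sum-even (-‿cong-mod (multiple≡0-mod {σ₃})))) ⟩
    0ℤ ∎
    where
    open ≡-mod-Reasoning (+ 72 * + k)
    regroup : ∀ a b c d → a + b + c + d - d * + 2 ≡ a + b + c - d
    regroup = solve-∀
    identity : ∀ k h u a b c d →
      + 3 * ((+ 12 * k * a - + 3 * k * (k - 1ℤ) - (k * k - 1ℤ) * (+ 6 * h - 1ℤ * u))
           + (+ 12 * k * b - + 3 * k * (k - 1ℤ) - (k * k - 1ℤ) * (+ 2 * h - + 3 * u))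
           + (+ 12 * k * c - + 3 * k * (k - 1ℤ) - (k * k - 1ℤ) * (h - + 6 * u))
           - (+ 12 * k * d - + 3 * k * (k - 1ℤ) - (k * k - 1ℤ) * (+ 3 * h - + 2 * u)))
        + + 2 * (- (+ 9 * k) + + 9 * k * k + h * (- + 9 + + 9 * k * k) + (u * + 6) * (+ 2 - + 2 * k * k))
      ≡ + 36 * k * (a + b + c - d)
    identity = solve-∀

  second-numerator≡0 : + 3 * (θ₃ + θ₂ + θ₁ - + 3 * θ₆) - + 4 * R₂ ≡ 0ℤ mod + 72 * + k
  second-numerator≡0 = begin
    + 3 * (θ₃ + θ₂ + θ₁ - + 3 * θ₆) - + 4 * R₂
      ≈⟨ +-cong-mod (scale-mod (+-cong-mod (+-cong-mod (+-cong-mod θ₃≡ρ₃ θ₂≡ρ₂) θ₁≡ρ₁)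
                                           (-‿cong-mod (*-cong-mod (≡-mod-refl {+ 3}) θ₆≡ρ₆))))
                    (≡-mod-refl { - (+ 4 * R₂)}) ⟩
    + 3 * (ρ₃ + ρ₂ + ρ₁ - + 3 * ρ₆) - + 4 * R₂
      ≡⟨ identity (+ k) h u σ₆ σ₂ σ₁ σ₃ ⟩
    + 36 * + k * (σ₃ + σ₂ + σ₁ - + 3 * σ₆)
      ≈⟨ 36k*even≡0 (subst (λ z → z ≡ 0ℤ mod + 2) (regroup σ₆ σ₂ σ₁ σ₃)
                           (+-cong-mod σ-sum-even (-‿cong-mod (multiple≡0-mod {+ 2 * σ₆})))) ⟩
    0ℤ ∎
    where
    open ≡-mod-Reasoning (+ 72 * + k)
    regroup : ∀ a b c d → a + b + c + d - + 2 * a * + 2 ≡ d + b + c - + 3 * a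
    regroup = solve-∀
    identity : ∀ k h u a b c d →
      + 3 * ((+ 12 * k * d - + 3 * k * (k - 1ℤ) - (k * k - 1ℤ) * (+ 3 * h - + 2 * u))
           + (+ 12 * k * b - + 3 * k * (k - 1ℤ) - (k * k - 1ℤ) * (+ 2 * h - + 3 * u))
           + (+ 12 * k * c - + 3 * k * (k - 1ℤ) - (k * k - 1ℤ) * (h - + 6 * u))
           - + 3 * (+ 12 * k * a - + 3 * k * (k - 1ℤ) - (k * k - 1ℤ) * (+ 6 * h - 1ℤ * u)))
        - + 4 * (+ 9 * h * (k * k - + 1) + (u * + 6) * (k * k - + 1))
      ≡ + 36 * k * (d + b + c - + 3 * a)
    identity = solve-∀

  first-identity :
    (ωangle (+ 6 * h) k ℚ.+ ωangle (+ 2 * h) k ℚ.+ ωangle h k ℚ.- ωangle (+ 3 * h) k)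
      ≈₁ ℚ.- ((R₁ ÷ (36 ℕ.* k)) {{ℕ.m*n≢0 36 k}})
  first-identity rewrite ωangle≡θ (+ 6 * h) | ωangle≡θ (+ 2 * h) | ωangle≡θ h | ωangle≡θ (+ 3 * h) =
    subst IsInteger (sym (sum-of-angles₁ k θ₆ θ₂ θ₁ θ₃ R₁))
      (isInteger-/ _ (72 ℕ.* k) {{ℕ.m*n≢0 72 k}} (≡-mod-resp-modulus (sym (ℤ.pos-* 72 k)) first-numerator≡0))

  second-identity :
    (ωangle (+ 3 * h) k ℚ.+ ωangle (+ 2 * h) k ℚ.+ ωangle h k ℚ.- (+ 3 ℚ./ 1) ℚ.* ωangle (+ 6 * h) k)
      ≈₁ (R₂ ÷ (18 ℕ.* k)) {{ℕ.m*n≢0 18 k}}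
  second-identity rewrite ωangle≡θ (+ 3 * h) | ωangle≡θ (+ 2 * h) | ωangle≡θ h | ωangle≡θ (+ 6 * h) =
    subst IsInteger (sym (sum-of-angles₂ k θ₃ θ₂ θ₁ θ₆ R₂))
      (isInteger-/ _ (72 ℕ.* k) {{ℕ.m*n≢0 72 k}} (≡-mod-resp-modulus (sym (ℤ.pos-* 72 k)) second-numerator≡0))

coprime⇒∤ : ∀ {m n} → ℕ.Coprime m n → Prime p → p ℕ.∣ m → ¬ p ℕ.∣ n
coprime⇒∤ m⊥n pr p∣m p∣n = ℕ.nonTrivial⇒≢1 {{prime⇒nonTrivial pr}} (m⊥n (p∣m , p∣n))

6hh⊥k : ∀ {k h} → gcd k 6 ≡ 1 → Coprime h (+ k) → Prime p → p ℕ.∣ k → ¬ + 6 * h * h ≡ 0ℤ mod + p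
6hh⊥k {k = k} {h} g6 h⊥k pr p∣k 6hh≡0 with euclidsLemma-mod {a = + 6 * h} {b = h} pr 6hh≡0
... | inj₂ h≡0 = coprime⇒∤ (ℕ.sym h⊥k) pr p∣k (Signed.∣⇒∣ᵤ (≡0-mod⇒∣ h≡0))
... | inj₁ 6h≡0 with euclidsLemma-mod {a = + 6} {b = h} pr 6h≡0
...   | inj₂ h≡0 = coprime⇒∤ (ℕ.sym h⊥k) pr p∣k (Signed.∣⇒∣ᵤ (≡0-mod⇒∣ h≡0))
...   | inj₁ 6≡0 = coprime⇒∤ (ℕ.gcd≡1⇒coprime {k} {6} g6) pr p∣k (Signed.∣⇒∣ᵤ (≡0-mod⇒∣ 6≡0))

lemma3p7 : (k : ℕ) .{{_ : NonZero k}} → gcd k 6 ≡ 1 →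
    (h : ℤ) → Coprime h (+ k) →
    (h' : ℤ) → (+ k) ∣ (h ℤ.* h' ℤ.+ + 1) → (+ 6) ∣ h' →
    ((ωangle (+ 6 ℤ.* h) k ℚ.+ ωangle (+ 2 ℤ.* h) k ℚ.+ ωangle h k ℚ.- ωangle (+ 3 ℤ.* h) k)
      ≈₁ ℚ.- (((ℤ.- (+ 9 ℤ.* + k) ℤ.+ + 9 ℤ.* + k ℤ.* + k
               ℤ.+ h ℤ.* (ℤ.- + 9 ℤ.+ + 9 ℤ.* + k ℤ.* + k)
               ℤ.+ h' ℤ.* (+ 2 ℤ.- + 2 ℤ.* + k ℤ.* + k)) ÷ (36 ℕ.* k)) {{m*n≢0 36 k}}))
    × ((ωangle (+ 3 ℤ.* h) k ℚ.+ ωangle (+ 2 ℤ.* h) k ℚ.+ ωangle h k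
         ℚ.- (+ 3 ℚ./ 1) ℚ.* ωangle (+ 6 ℤ.* h) k)
      ≈₁ (((+ 9 ℤ.* h ℤ.* (+ k ℤ.* + k ℤ.- + 1) ℤ.+ h' ℤ.* (+ k ℤ.* + k ℤ.- + 1)) ÷ (18 ℕ.* k)) {{m*n≢0 18 k}}))
lemma3p7 k g6 h h⊥k h' k∣hh'+1 6∣h' with Signed.∣ᵤ⇒∣ {+ 6} {h'} 6∣h'
... | Signed.divides u refl = first-identity , second-identity
  where
  k-odd : ¬ 2 ℕ.∣ k
  k-odd 2∣k = contradiction (ℕ.gcd≡1⇒coprime {k} {6} g6 (2∣k , ℕ.divides 3 refl)) λ ()
  3∤k : ¬ 3 ℕ.∣ k
  3∤k 3∣k = contradiction (ℕ.gcd≡1⇒coprime {k} {6} g6 (3∣k , ℕ.divides 2 refl)) λ ()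
  open MultiplierQuotients k k-odd 3∤k h (6hh⊥k {h = h} g6 h⊥k) u (∣⇒≡-mod (Signed.∣ᵤ⇒∣ k∣hh'+1))
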